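{- For every integer $d \ge 1$, the polynomial $F_d(x,y)$ equals the Euler--Mahonian polynomial $E_d(x,y)$, i.e. \[ F_d(x,y) \,=\, \sum_{\tau \in S_d} x^{\operatorname{des}(\tau)} y^{\operatorname{maj}(\tau)} . \]
   Context: For $d \ge 1$, define $F_d(q_0,w)$ recursively by $F_1(q_0,w) = 1$ and, for $d \ge 2$, \[ F_d(q_0,w) \,=\, \frac{(1 - q_0 w^d)\, F_{d-1}(q_0,w) \;-\; w(1-q_0)\, F_{d-1}(q_0 w, w)}{1-w} \] (these are polynomials in $\mathbb{Z}[q_0,w]$). For a permutation $\tau$ of $\{1,\dots,d\}$ (an element of the symmetric group $S_d$), let $\operatorname{Des}(\tau) := \{ j \in \{1,\dots,d-1\} : \tau(j) > \tau(j+1)\}$ be its descent set, $\operatorname{des}(\tau) := |\operatorname{Des}(\tau)|$, and $\operatorname{maj}(\tau) := \sum_{j \in \operatorname{Des}(\tau)} j$. The Euler--Mahonian polynomial is $E_d(x,y) := \sum_{\tau \in S_d} x^{\operatorname{des}(\tau)} y^{\operatorname{maj}(\tau)}$. -}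

module Defs where

open import Data.Nat using (ℕ; zero; suc; _∸_; _≤ᵇ_; _<ᵇ_)
import Data.Nat as N
open import Data.Integer using (ℤ; +_; _-_)
import Data.Integer as Z
open import Data.Bool using (Bool; true; false; if_then_else_; _∧_)
open import Data.Fin using (Fin; toℕ)
import Data.Fin as F
open import Data.Vec using (Vec; []; _∷_; toList)
open import Data.List using (List; []; _∷_; map; concatMap; length; filter; allFin)
open import Data.List.Relation.Unary.Unique.Propositional using (Unique)
import Data.List.Relation.Unary.Unique.DecPropositional as UD
open import Data.Product using (_×_; _,_)
open import Relation.Nullary.Decidable using (_×-dec_)
open import Relation.Binary.PropositionalEquality using (_≡_)

-- Formal power series in ℤ[[q₀,w]], as coefficient functions:
-- S i j = coefficient of q₀^i w^j.  ℤ[q₀,w] embeds in ℤ[[q₀,w]], and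
-- there (1 - w) is invertible, so the exact division in the recursion
-- for F_d is division by (1-w) in ℤ[[q₀,w]].

Ser : Set
Ser = ℕ → ℕ → ℤ

one : Ser
one zero zero = + 1
one _    _    = + 0

_⊕_ : Ser → Ser → Ser
(f ⊕ g) i j = f i j Z.+ g i j

_⊖_ : Ser → Ser → Ser
(f ⊖ g) i j = f i j - g i j

mono : ℕ → ℕ → Ser → Ser
mono a b f i j = if (a ≤ᵇ i) ∧ (b ≤ᵇ j) then f (i ∸ a) (j ∸ b) else + 0

-- substitution q₀ ↦ q₀ w :  G(q₀ w, w)
substQW : Ser → Ser
substQW f i j = if i ≤ᵇ j then f i (j ∸ i) else + 0

-- division by (1 - w): multiplication by 1/(1-w) = Σ_k w^k
sumTo : (ℕ → ℤ) → ℕ → ℤ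
sumTo h zero    = h zero
sumTo h (suc k) = sumTo h k Z.+ h (suc k)

div1-w : Ser → Ser
div1-w f i j = sumTo (f i) j

-- one step of the recursion, for index d:
-- F_d = ((1 - q₀ w^d) G - w (1 - q₀) G(q₀ w, w)) / (1 - w),  G = F_{d-1}
step : ℕ → Ser → Ser
step d G = div1-w ((G ⊖ mono 1 d G) ⊖ (mono 0 1 (substQW G ⊖ mono 1 0 (substQW G))))

-- F d = F_d for d ≥ 1 (F 0 is an unused dummy value)
F : ℕ → Ser
F zero          = one
F (suc zero)    = one
F (suc (suc n)) = step (suc (suc n)) (F (suc n))

-- Permutations of {1,…,d} in one-line notation: τ ↦ (τ(1),…,τ(d)),
-- values shifted to Fin d; a word is a permutation iff its entries are
-- pairwise distinct.

words : (d n : ℕ) → List (Vec (Fin d) n)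
words d zero    = [] ∷ []
words d (suc n) = concatMap (λ x → map (x ∷_) (words d n)) (allFin d)

-- descents: position k (1-indexed) is a descent iff τ(k) > τ(k+1)
-- desFrom k w : number of descents, majFrom k w : sum of descent positions,
-- where the head of w sits at position k.
desFrom : ℕ → List ℕ → ℕ
desFrom k []            = 0
desFrom k (a ∷ [])      = 0
desFrom k (a ∷ b ∷ xs)  = (if b <ᵇ a then 1 else 0) N.+ desFrom (suc k) (b ∷ xs)

majFrom : ℕ → List ℕ → ℕ
majFrom k []            = 0
majFrom k (a ∷ [])      = 0
majFrom k (a ∷ b ∷ xs)  = (if b <ᵇ a then k else 0) N.+ majFrom (suc k) (b ∷ xs)

des : ∀ {d} → Vec (Fin d) d → ℕ
des τ = desFrom 1 (map toℕ (toList τ))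

maj : ∀ {d} → Vec (Fin d) d → ℕ
maj τ = majFrom 1 (map toℕ (toList τ))

-- coefficient of x^i y^j in E_d(x,y) = Σ_{τ ∈ S_d} x^des(τ) y^maj(τ):
-- number of τ ∈ S_d with des τ = i and maj τ = j
E : ℕ → ℕ → ℕ → ℕ
E d i j = length (filter (λ τ → UD.unique? (F._≟_ {d}) (toList τ) ×-dec (des τ N.≟ i ×-dec maj τ N.≟ j)) (words d d))

-- Insert the largest letter d into the d + 1 slots of a permutation σ of {0,…,d-1} with
-- des σ = k and maj σ = m.  Inserting at the end or into one of the k descents keeps k
-- descents and raises maj by 0, 1, …, k; inserting at the front or into one of the other
-- d - k - 1 slots creates a descent and raises maj by k+1, …, d.  So the monomial q₀^k w^m
-- of E_d becomes q₀^k w^m ((1 - w^(k+1)) + q₀ (w^(k+1) - w^(d+1))) / (1 - w) in E_(d+1),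
-- and as Σ q₀^k w^(m+k) = E_d(q₀ w, w), summing over σ gives exactly the recursion that
-- defines F_(d+1).

module Submission where

open import Defs
open import Data.Nat using (ℕ; _≤_)
open import Data.Integer using (+_)
open import Relation.Binary.PropositionalEquality using (_≡_)

open import Data.Bool using (Bool; true; false; T; _∧_; if_then_else_)
open import Data.Bool.Properties using (T-∧)
open import Data.Empty using (⊥-elim)
open import Data.Fin as Fin using (Fin; toℕ; fromℕ<)
open import Data.Fin.Properties using (toℕ-injective; toℕ<n; toℕ-fromℕ<)
open import Data.Integer as ℤ using (_-_)
import Data.Integer.Properties as ℤP
open import Data.Integer.Tactic.RingSolver using (solve-∀)
open import Data.List using (List; []; _∷_; [_]; _++_; map; concatMap; length; filter; allFin)
open import Data.List.Properties
  using (map-∘; map-++; map-injective; length-map; length-++; length-++-sucʳ; ++-assoc;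
         concatMap-pure; concatMap-map; map-concatMap; filter-++; filter-≐; filter-none; filter-reject;
         filter-all; ∷-injectiveˡ; ∷-injectiveʳ)
open import Data.List.Membership.Propositional using (_∈_; _∉_; find; lose)
open import Data.List.Membership.Propositional.Properties
  using (∈-allFin; ∈-map⁺; ∈-map⁻; ∈-∃++; ∈-filter⁺; ∈-filter⁻; ∈-concatMap⁺; ∈-concatMap⁻; ∈-concat⁺′)
open import Data.List.Membership.Propositional.Properties.WithK using (unique∧set⇒bag)
open import Data.List.Relation.Binary.BagAndSetEquality using (∼bag⇒↭)
open import Data.List.Relation.Binary.Permutation.Propositional
  using (_↭_; ↭-refl; ↭-sym; ↭-reflexive; prep; ↭⇒↭ₛ; module PermutationReasoning)
open import Data.List.Relation.Binary.Permutation.Propositional.Properties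
  using (↭-length; filter-↭; map⁺; shift; shifts; ++⁺; ++⁺ˡ; ++⁺ʳ; ++-comm; All-resp-↭)
open import Data.List.Relation.Unary.All as All using (All; []; _∷_)
import Data.List.Relation.Unary.All.Properties as All
import Data.List.Relation.Unary.AllPairs as AllPairs
import Data.List.Relation.Unary.AllPairs.Properties as AllPairs
open import Data.List.Relation.Unary.Any using (here; there)
open import Data.List.Relation.Unary.Unique.Propositional using (Unique; []; _∷_)
import Data.List.Relation.Unary.Unique.Propositional.Properties as Unique
import Data.List.Relation.Unary.Unique.DecPropositional as UniqueDec
open import Data.Nat using (zero; suc; _+_; _∸_; _<_; _≤ᵇ_; _<ᵇ_; _≟_; z≤n; s≤s)
open import Data.Nat.Properties
  using (≤⇒≤ᵇ; ≤ᵇ⇒≤; <ᵇ-reflects-<; m≤m+n; m+n∸m≡n; m+[n∸m]≡n; +-∸-assoc; +-identityʳ; +-comm; +-assoc;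
         +-suc; suc-injective; ≤-pred; ≤∧≢⇒<; <-irrefl; <-asym; n<1+n; m<n⇒m<1+n; m≤n⇒m≤1+n)
open import Data.List.Membership.DecPropositional _≟_ using (_∈?_)
open import Data.Product using (_×_; _,_; proj₁; proj₂; ∃₂)
open import Data.Vec as Vec using (Vec; toList)
open import Data.Vec.Properties as Vec using (toList-injective; cast-is-id; length-toList)
open import Function using (_∘_; _⇔_; mk⇔; Equivalence)
open import Level using (0ℓ)
open import Relation.Binary.PropositionalEquality
  using (_≢_; refl; sym; trans; cong; cong₂; subst; setoid; module ≡-Reasoning)
open import Relation.Nullary using (¬_; yes; no; ¬?)
open import Relation.Nullary.Decidable using (does; _×-dec_)
open import Relation.Nullary.Reflects using (ofʸ; ofⁿ)
open import Relation.Unary using (Pred; Decidable)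
open import Data.List.Relation.Binary.Permutation.Setoid.Properties (setoid ℕ) using (Unique-resp-↭)

open Equivalence using (to; from)

length-filter-map : ∀ {A B : Set} {p} {P : Pred B p} (P? : Decidable P) (f : A → B) xs →
                    length (filter P? (map f xs)) ≡ length (filter (P? ∘ f) xs)
length-filter-map P? f []       = refl
length-filter-map P? f (x ∷ xs) with does (P? (f x))
... | true  = cong suc (length-filter-map P? f xs)
... | false = length-filter-map P? f xs

filter-×-dec : ∀ {A : Set} {p q} {P : Pred A p} {Q : Pred A q} (P? : Decidable P) (Q? : Decidable Q) xs →
               filter (λ x → P? x ×-dec Q? x) xs ≡ filter Q? (filter P? xs)
filter-×-dec P? Q? []       = refl
filter-×-dec P? Q? (x ∷ xs) with does (P? x)
... | false = filter-×-dec P? Q? xs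
... | true  with does (Q? x)
...   | true  = cong (x ∷_) (filter-×-dec P? Q? xs)
...   | false = filter-×-dec P? Q? xs

map-as-concatMap : ∀ {A B : Set} (f : A → B) xs → map f xs ≡ concatMap (λ x → [ f x ]) xs
map-as-concatMap f xs = trans (sym (concatMap-pure (map f xs))) (concatMap-map [_] f xs)

concatMap-cong-↭ : ∀ {A B : Set} {f g : A → List B} {xs} →
                   All (λ x → f x ↭ g x) xs → concatMap f xs ↭ concatMap g xs
concatMap-cong-↭ []       = ↭-refl
concatMap-cong-↭ (p ∷ ps) = ++⁺ p (concatMap-cong-↭ ps)

concatMap-++-↭ : ∀ {A B : Set} (f g : A → List B) xs →
                 concatMap (λ x → f x ++ g x) xs ↭ concatMap f xs ++ concatMap g xs
concatMap-++-↭ f g []       = ↭-refl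
concatMap-++-↭ f g (x ∷ xs) = begin
  (f x ++ g x) ++ concatMap (λ x → f x ++ g x) xs  ↭⟨ ++⁺ˡ (f x ++ g x) (concatMap-++-↭ f g xs) ⟩
  (f x ++ g x) ++ (Fs ++ Gs)                        ≡⟨ ++-assoc (f x) (g x) (Fs ++ Gs) ⟩
  f x ++ (g x ++ Fs ++ Gs)                          ↭⟨ ++⁺ˡ (f x) (shifts (g x) Fs) ⟩
  f x ++ (Fs ++ g x ++ Gs)                          ≡⟨ ++-assoc (f x) Fs (g x ++ Gs) ⟨
  (f x ++ Fs) ++ (g x ++ Gs)                        ∎
  where
  open PermutationReasoning
  Fs = concatMap f xs
  Gs = concatMap g xs

_≗₂_ : Ser → Ser → Set
f ≗₂ g = ∀ i j → f i j ≡ g i j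

AtExponent : ℕ → ℕ → Pred (ℕ × ℕ) 0ℓ
AtExponent i j (a , b) = a ≡ i × b ≡ j

atExponent? : ∀ i j → Decidable (AtExponent i j)
atExponent? i j (a , b) = (a ≟ i) ×-dec (b ≟ j)

-- The pair (a , b) stands for the monomial q₀^a w^b, so series A = Σ_{(a,b) ∈ A} q₀^a w^b
-- and identities between such polynomials become permutations (↭) of exponent lists.
series : List (ℕ × ℕ) → Ser
series A i j = + length (filter (atExponent? i j) A)

series-↭ : ∀ {A B} → A ↭ B → series A ≗₂ series B
series-↭ A↭B i j = cong +_ (↭-length (filter-↭ (atExponent? i j) A↭B))

series-++ : ∀ A B → series (A ++ B) ≗₂ (series A ⊕ series B)
series-++ A B i j = begin
  + length (filter P? (A ++ B))                    ≡⟨ cong (+_ ∘ length) (filter-++ P? A B) ⟩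
  + length (filter P? A ++ filter P? B)             ≡⟨ cong +_ (length-++ (filter P? A)) ⟩
  + (length (filter P? A) + length (filter P? B))   ≡⟨ ℤP.pos-+ (length (filter P? A)) _ ⟩
  series A i j ℤ.+ series B i j                    ∎
  where
  open ≡-Reasoning
  P? = atExponent? i j

series-cancel : ∀ A B C D → A ++ D ↭ C ++ B → (series A ⊖ series B) ≗₂ (series C ⊖ series D)
series-cancel A B C D A+D↭C+B i j = begin
  a - b                   ≡⟨ cancelʳ a b d ⟨
  (a ℤ.+ d) - (b ℤ.+ d)   ≡⟨ cong (_- (b ℤ.+ d)) a+d≡c+b ⟩
  (c ℤ.+ b) - (b ℤ.+ d)   ≡⟨ cancelˡ c b d ⟩
  c - d                   ∎
  where
  open ≡-Reasoning
  a = series A i j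
  b = series B i j
  c = series C i j
  d = series D i j
  a+d≡c+b : a ℤ.+ d ≡ c ℤ.+ b
  a+d≡c+b = trans (sym (series-++ A D i j)) (trans (series-↭ A+D↭C+B i j) (series-++ C B i j))
  cancelʳ : ∀ x y z → (x ℤ.+ z) - (y ℤ.+ z) ≡ x - y
  cancelʳ = solve-∀
  cancelˡ : ∀ x y z → (x ℤ.+ y) - (y ℤ.+ z) ≡ x - z
  cancelˡ = solve-∀

series-map : ∀ (f : ℕ × ℕ → ℕ × ℕ) {i j i′ j′} c →
             (∀ s → AtExponent i j (f s) ⇔ (T c × AtExponent i′ j′ s)) →
             ∀ A → series (map f A) i j ≡ (if c then series A i′ j′ else + 0)
series-map f {i} {j} {i′} {j′} true f⇔ A = cong +_ (begin
  length (filter (atExponent? i j) (map f A))  ≡⟨ length-filter-map (atExponent? i j) f A ⟩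
  length (filter (atExponent? i j ∘ f) A)      ≡⟨ cong length (filter-≐ _ (atExponent? i′ j′) same A) ⟩
  length (filter (atExponent? i′ j′) A)        ∎)
  where
  open ≡-Reasoning
  same = (λ {s} at → proj₂ (to (f⇔ s) at)) , (λ {s} at → from (f⇔ s) (_ , at))
series-map f {i} {j} false f⇔ A = cong +_ (begin
  length (filter (atExponent? i j) (map f A))  ≡⟨ length-filter-map (atExponent? i j) f A ⟩
  length (filter (atExponent? i j ∘ f) A)      ≡⟨ cong length (filter-none _ (All.universal never A)) ⟩
  0                                             ∎)
  where
  open ≡-Reasoning
  never = λ s at → proj₁ (to (f⇔ s) at)

shiftExp : ℕ → ℕ → ℕ × ℕ → ℕ × ℕ
shiftExp a b (k , m) = (a + k , b + m)

tiltExp : ℕ × ℕ → ℕ × ℕ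
tiltExp (k , m) = (k , m + k)

+-≡⇔ : ∀ a k i → (a + k ≡ i) ⇔ (T (a ≤ᵇ i) × k ≡ i ∸ a)
+-≡⇔ a k i = mk⇔ (λ { refl → ≤⇒≤ᵇ (m≤m+n a k) , sym (m+n∸m≡n a k) })
                 (λ { (a≤i , refl) → m+[n∸m]≡n (≤ᵇ⇒≤ a i a≤i) })

mono-series : ∀ a b {G} A → G ≗₂ series A → mono a b G ≗₂ series (map (shiftExp a b) A)
mono-series a b {G} A G≗A i j = begin
  mono a b G i j                                  ≡⟨ cong (if c then_else + 0) (G≗A (i ∸ a) (j ∸ b)) ⟩
  (if c then series A (i ∸ a) (j ∸ b) else + 0)  ≡⟨ series-map (shiftExp a b) c shift⇔ A ⟨
  series (map (shiftExp a b) A) i j               ∎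
  where
  open ≡-Reasoning
  c = (a ≤ᵇ i) ∧ (b ≤ᵇ j)
  shift⇔ : ∀ s → AtExponent i j (shiftExp a b s) ⇔ (T c × AtExponent (i ∸ a) (j ∸ b) s)
  shift⇔ (k , m) = mk⇔
    (λ (a+k≡i , b+m≡j) → let (a≤i , k≡) = to (+-≡⇔ a k i) a+k≡i
                             (b≤j , m≡) = to (+-≡⇔ b m j) b+m≡j
                         in from T-∧ (a≤i , b≤j) , k≡ , m≡)
    (λ (t , k≡ , m≡) → let (a≤i , b≤j) = to T-∧ t
                       in from (+-≡⇔ a k i) (a≤i , k≡) , from (+-≡⇔ b m j) (b≤j , m≡))

substQW-series : ∀ {G} A → G ≗₂ series A → substQW G ≗₂ series (map tiltExp A)
substQW-series {G} A G≗A i j = begin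
  substQW G i j                                 ≡⟨ cong (if i ≤ᵇ j then_else + 0) (G≗A i (j ∸ i)) ⟩
  (if i ≤ᵇ j then series A i (j ∸ i) else + 0)  ≡⟨ series-map tiltExp (i ≤ᵇ j) tilt⇔ A ⟨
  series (map tiltExp A) i j                    ∎
  where
  open ≡-Reasoning
  tilt⇔ : ∀ s → AtExponent i j (tiltExp s) ⇔ (T (i ≤ᵇ j) × AtExponent i (j ∸ i) s)
  tilt⇔ (k , m) = mk⇔
    (λ { (refl , m+k≡j) → let (k≤j , m≡) = to (+-≡⇔ k m j) (trans (+-comm k m) m+k≡j)
                          in k≤j , refl , m≡ })
    (λ { (i≤j , refl , m≡) → refl , trans (+-comm m i) (from (+-≡⇔ i m j) (i≤j , m≡)) })

mono-⊖ : ∀ a b f g → mono a b (f ⊖ g) ≗₂ (mono a b f ⊖ mono a b g)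
mono-⊖ a b f g i j with (a ≤ᵇ i) ∧ (b ≤ᵇ j)
... | true  = refl
... | false = refl

numerator : ℕ → Ser → Ser
numerator d G = (G ⊖ mono 1 d G) ⊖ mono 0 1 (substQW G ⊖ mono 1 0 (substQW G))

numerator-series : ∀ d {G} S → G ≗₂ series S →
  numerator d G ≗₂ (series (S ++ map (shiftExp 1 1 ∘ tiltExp) S)
                    ⊖ series (map (shiftExp 1 d) S ++ map (shiftExp 0 1 ∘ tiltExp) S))
numerator-series d {G} S G≗S i j = begin
  (G i j - mono 1 d G i j) - mono 0 1 (substQW G ⊖ mono 1 0 (substQW G)) i j
    ≡⟨ cong₂ _-_ (cong₂ _-_ (G≗S i j) (mono-series 1 d S G≗S i j))
                 (trans (mono-⊖ 0 1 (substQW G) (mono 1 0 (substQW G)) i j) (cong₂ _-_ w-tilted wq-tilted)) ⟩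
  (s - series S₁ i j) - (series S₂ i j - series S₃ i j)
    ≡⟨ rearrange s (series S₁ i j) (series S₂ i j) (series S₃ i j) ⟩
  (s ℤ.+ series S₃ i j) - (series S₁ i j ℤ.+ series S₂ i j)
    ≡⟨ cong₂ _-_ (series-++ S S₃ i j) (series-++ S₁ S₂ i j) ⟨
  series (S ++ S₃) i j - series (S₁ ++ S₂) i j
    ∎
  where
  open ≡-Reasoning
  s = series S i j
  S₁ = map (shiftExp 1 d) S
  S₂ = map (shiftExp 0 1 ∘ tiltExp) S
  S₃ = map (shiftExp 1 1 ∘ tiltExp) S
  tilted : substQW G ≗₂ series (map tiltExp S)
  tilted = substQW-series S G≗S
  w-tilted : mono 0 1 (substQW G) i j ≡ series S₂ i j
  w-tilted = trans (mono-series 0 1 (map tiltExp S) tilted i j) (cong (λ L → series L i j) (sym (map-∘ S)))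
  wq-tilted : mono 0 1 (mono 1 0 (substQW G)) i j ≡ series S₃ i j
  wq-tilted = trans (mono-series 0 1 (map (shiftExp 1 0) (map tiltExp S))
                                 (mono-series 1 0 (map tiltExp S) tilted) i j)
                    (cong (λ L → series L i j) (trans (sym (map-∘ {g = shiftExp 0 1} (map tiltExp S)))
                                                      (sym (map-∘ {g = shiftExp 0 1 ∘ shiftExp 1 0} S))))
  rearrange : ∀ a b c e → (a - b) - (c - e) ≡ (a ℤ.+ e) - (b ℤ.+ c)
  rearrange = solve-∀

div1-w-inverse : ∀ {f h : Ser} → f ≗₂ (h ⊖ mono 0 1 h) → div1-w f ≗₂ h
div1-w-inverse {f} {h} f≗ i zero    = trans (f≗ i 0) (ℤP.+-identityʳ (h i 0))
div1-w-inverse {f} {h} f≗ i (suc j) = begin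
  sumTo (f i) j ℤ.+ f i (suc j)    ≡⟨ cong₂ ℤ._+_ (div1-w-inverse {h = h} f≗ i j) (f≗ i (suc j)) ⟩
  h i j ℤ.+ (h i (suc j) - h i j)  ≡⟨ telescope (h i j) (h i (suc j)) ⟩
  h i (suc j)                      ∎
  where
  open ≡-Reasoning
  telescope : ∀ a b → a ℤ.+ (b - a) ≡ b
  telescope = solve-∀

-- The insertion polynomial

row : ℕ → ℕ → ℕ → List (ℕ × ℕ)
row k m zero    = []
row k m (suc r) = (k , m) ∷ row k (suc m) r

row-snoc : ∀ k m r → row k m (suc r) ≡ row k m r ++ [ (k , m + r) ]
row-snoc k m zero    = cong (λ x → [ (k , x) ]) (sym (+-identityʳ m))
row-snoc k m (suc r) = cong ((k , m) ∷_) (begin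
  row k (suc m) (suc r)                  ≡⟨ row-snoc k (suc m) r ⟩
  row k (suc m) r ++ [ (k , suc m + r) ] ≡⟨ cong (λ x → row k (suc m) r ++ [ (k , x) ]) (+-suc m r) ⟨
  row k (suc m) r ++ [ (k , m + suc r) ] ∎)
  where open ≡-Reasoning

map-row : ∀ (f : ℕ × ℕ → ℕ × ℕ) {k k′} (g : ℕ → ℕ) →
          (∀ m → f (k , m) ≡ (k′ , g m)) → (∀ m → g (suc m) ≡ suc (g m)) →
          ∀ m r → map f (row k m r) ≡ row k′ (g m) r
map-row f g f-row g-suc m zero    = refl
map-row f g f-row g-suc m (suc r) =
  cong₂ _∷_ (f-row m) (trans (map-row f g f-row g-suc (suc m) r) (cong (λ x → row _ x r) (g-suc m)))

-- q₀^k w^m ([k+1]_w + q₀ w^(k+1) [n-k]_w): the (des , maj) of the n+1 ways to insert a new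
-- maximum into a word of length n with statistics (k , m).
insertionStats : ℕ → ℕ × ℕ → List (ℕ × ℕ)
insertionStats n (k , m) = row k m (suc k) ++ row (suc k) (suc (m + k)) (n ∸ k)

insertionStats-telescopes : ∀ n {k} m → k ≤ n →
  (k , m) ∷ (suc k , suc (m + k)) ∷ map (shiftExp 0 1) (insertionStats n (k , m))
    ↭ insertionStats n (k , m) ++ (suc k , suc n + m) ∷ (k , suc (m + k)) ∷ []
insertionStats-telescopes n {k} m k≤n = begin
  (k , m) ∷ (suc k , suc (m + k)) ∷ map (shiftExp 0 1) (R₁ ++ R₂)
    ≡⟨ cong (λ L → (k , m) ∷ (suc k , suc (m + k)) ∷ L) (trans (map-++ (shiftExp 0 1) R₁ R₂)
         (cong₂ _++_ (map-row _ suc (λ _ → refl) (λ _ → refl) m (suc k))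
                     (map-row _ suc (λ _ → refl) (λ _ → refl) (suc (m + k)) r))) ⟩
  (k , m) ∷ (suc k , suc (m + k)) ∷ (row k (suc m) (suc k) ++ row (suc k) (suc (suc (m + k))) r)
    ↭⟨ prep (k , m) (↭-sym (shift (suc k , suc (m + k)) (row k (suc m) (suc k)) _)) ⟩
  row k m (suc (suc k)) ++ row (suc k) (suc (m + k)) (suc r)
    ≡⟨ cong₂ _++_ (row-snoc k m (suc k)) (row-snoc (suc k) (suc (m + k)) r) ⟩
  (R₁ ++ [ (k , m + suc k) ]) ++ (R₂ ++ [ (suc k , suc (m + k) + r) ])
    ≡⟨ cong₂ (λ x y → (R₁ ++ [ (k , x) ]) ++ (R₂ ++ [ (suc k , y) ])) (+-suc m k) last-maj ⟩
  (R₁ ++ [ b ]) ++ (R₂ ++ [ a ])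
    ≡⟨ ++-assoc R₁ [ b ] (R₂ ++ [ a ]) ⟩
  R₁ ++ (b ∷ R₂ ++ [ a ])
    ↭⟨ ++⁺ˡ R₁ (++-comm [ b ] (R₂ ++ [ a ])) ⟩
  R₁ ++ ((R₂ ++ [ a ]) ++ [ b ])
    ≡⟨ cong (R₁ ++_) (++-assoc R₂ [ a ] [ b ]) ⟩
  R₁ ++ (R₂ ++ a ∷ b ∷ [])
    ≡⟨ ++-assoc R₁ R₂ (a ∷ b ∷ []) ⟨
  (R₁ ++ R₂) ++ a ∷ b ∷ [] ∎
  where
  open PermutationReasoning
  r = n ∸ k
  R₁ = row k m (suc k)
  R₂ = row (suc k) (suc (m + k)) r
  a = (suc k , suc n + m)
  b = (k , suc (m + k))
  last-maj : suc (m + k) + r ≡ suc n + m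
  last-maj = cong suc (trans (+-assoc m k r) (trans (cong (λ x → m + x) (m+[n∸m]≡n k≤n)) (+-comm m n)))

-- Multiplied out, this is (1 - q₀ w^(n+1)) G - w (1 - q₀) G(q₀ w, w) = (1 - w) H, where
-- G = series S and H is the sum of the insertion polynomials of its monomials.
insertionStats-balanced : ∀ n S → All (λ s → proj₁ s ≤ n) S →
  (S ++ map (shiftExp 1 1 ∘ tiltExp) S) ++ map (shiftExp 0 1) (concatMap (insertionStats n) S)
    ↭ concatMap (insertionStats n) S ++ (map (shiftExp 1 (suc n)) S ++ map (shiftExp 0 1 ∘ tiltExp) S)
insertionStats-balanced n S bounded = begin
  (S ++ map f₄ S) ++ map W (concatMap I S)
    ≡⟨ cong₂ _++_ (cong₂ _++_ (sym (concatMap-pure S)) (map-as-concatMap f₄ S)) (map-concatMap W I S) ⟩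
  (concatMap [_] S ++ concatMap ([_] ∘ f₄) S) ++ concatMap (map W ∘ I) S
    ↭⟨ ++⁺ʳ _ (concatMap-++-↭ [_] ([_] ∘ f₄) S) ⟨
  concatMap (λ s → s ∷ f₄ s ∷ []) S ++ concatMap (map W ∘ I) S
    ↭⟨ concatMap-++-↭ _ _ S ⟨
  concatMap (λ s → s ∷ f₄ s ∷ map W (I s)) S
    ↭⟨ concatMap-cong-↭ (All.map (λ {s} k≤n → insertionStats-telescopes n (proj₂ s) k≤n) bounded) ⟩
  concatMap (λ s → I s ++ f₂ s ∷ f₃ s ∷ []) S
    ↭⟨ concatMap-++-↭ _ _ S ⟩
  concatMap I S ++ concatMap (λ s → f₂ s ∷ f₃ s ∷ []) S
    ↭⟨ ++⁺ˡ _ (concatMap-++-↭ ([_] ∘ f₂) ([_] ∘ f₃) S) ⟩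
  concatMap I S ++ (concatMap ([_] ∘ f₂) S ++ concatMap ([_] ∘ f₃) S)
    ≡⟨ cong (concatMap I S ++_) (cong₂ _++_ (map-as-concatMap f₂ S) (map-as-concatMap f₃ S)) ⟨
  concatMap I S ++ (map f₂ S ++ map f₃ S) ∎
  where
  open PermutationReasoning
  I = insertionStats n
  W = shiftExp 0 1
  f₂ = shiftExp 1 (suc n)
  f₃ = shiftExp 0 1 ∘ tiltExp
  f₄ = shiftExp 1 1 ∘ tiltExp

step-series : ∀ n {G} S → G ≗₂ series S → All (λ s → proj₁ s ≤ n) S →
              step (suc n) G ≗₂ series (concatMap (insertionStats n) S)
step-series n {G} S G≗S bounded = div1-w-inverse {f = numerator (suc n) G} (λ i j → begin
  numerator (suc n) G i j
    ≡⟨ numerator-series (suc n) S G≗S i j ⟩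
  series (S ++ map (shiftExp 1 1 ∘ tiltExp) S) i j
    - series (map (shiftExp 1 (suc n)) S ++ map (shiftExp 0 1 ∘ tiltExp) S) i j
    ≡⟨ series-cancel _ _ H (map (shiftExp 0 1) H) (insertionStats-balanced n S bounded) i j ⟩
  series H i j - series (map (shiftExp 0 1) H) i j
    ≡⟨ cong (series H i j -_) (mono-series 0 1 H (λ _ _ → refl) i j) ⟨
  series H i j - mono 0 1 (series H) i j ∎)
  where
  open ≡-Reasoning
  H = concatMap (insertionStats n) S

-- Descent statistics under insertion of a maximum

stats : List ℕ → ℕ × ℕ
stats l = desFrom 1 l , majFrom 1 l

desFrom-start : ∀ i j l → desFrom i l ≡ desFrom j l
desFrom-start i j []          = refl
desFrom-start i j (a ∷ [])    = refl
desFrom-start i j (a ∷ b ∷ l) =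
  cong (λ n → (if b <ᵇ a then 1 else 0) + n) (desFrom-start (suc i) (suc j) (b ∷ l))

majFrom-suc : ∀ i l → majFrom (suc i) l ≡ majFrom i l + desFrom i l
majFrom-suc i []          = refl
majFrom-suc i (a ∷ [])    = refl
majFrom-suc i (a ∷ b ∷ l) with b <ᵇ a | majFrom-suc (suc i) (b ∷ l)
... | false | ih = ih
... | true  | ih = trans (cong (λ n → suc i + n) ih)
                         (trans (cong suc (sym (+-assoc i _ _))) (sym (+-suc (i + _) _)))

desFrom-∷-≤ : ∀ i z ys → desFrom i (z ∷ ys) ≤ length ys
desFrom-∷-≤ i z []       = z≤n
desFrom-∷-≤ i z (b ∷ ys) with b <ᵇ z
... | true  = s≤s (desFrom-∷-≤ (suc i) b ys)
... | false = m≤n⇒m≤1+n (desFrom-∷-≤ (suc i) b ys)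

desFrom-≤ : ∀ i l → desFrom i l ≤ length l
desFrom-≤ i []       = z≤n
desFrom-≤ i (z ∷ ys) = m≤n⇒m≤1+n (desFrom-∷-≤ i z ys)

-- The statistics of y ∷ τ from those of τ, where c tells whether y ∷ τ starts with a descent:
-- every old descent moves one place to the right, which is the substitution q₀ ↦ q₀ w.
consStats : Bool → ℕ × ℕ → ℕ × ℕ
consStats false = tiltExp
consStats true  = shiftExp 1 1 ∘ tiltExp

stats-∷ : ∀ y z τ → stats (y ∷ z ∷ τ) ≡ consStats (z <ᵇ y) (stats (z ∷ τ))
stats-∷ y z τ with z <ᵇ y
... | false = cong₂ _,_ (desFrom-start 2 1 (z ∷ τ)) (majFrom-suc 1 (z ∷ τ))
... | true  = cong₂ _,_ (cong suc (desFrom-start 2 1 (z ∷ τ))) (cong suc (majFrom-suc 1 (z ∷ τ)))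

stats-ascent : ∀ {y z} τ → y < z → stats (y ∷ z ∷ τ) ≡ consStats false (stats (z ∷ τ))
stats-ascent {y} {z} τ y<z with z <ᵇ y | <ᵇ-reflects-< z y | stats-∷ y z τ
... | false | _       | eq = eq
... | true  | ofʸ z<y | _  = ⊥-elim (<-asym y<z z<y)

stats-descent : ∀ {y z} τ → z < y → stats (y ∷ z ∷ τ) ≡ consStats true (stats (z ∷ τ))
stats-descent {y} {z} τ z<y with z <ᵇ y | <ᵇ-reflects-< z y | stats-∷ y z τ
... | true  | _       | eq = eq
... | false | ofⁿ z≮y | _  = ⊥-elim (z≮y z<y)

inserts : ℕ → List ℕ → List (List ℕ)
inserts x []       = [ [ x ] ]
inserts x (y ∷ ys) = (x ∷ y ∷ ys) ∷ map (y ∷_) (inserts x ys)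

map-stats-∷ : ∀ y z (U : List (List ℕ)) →
  map stats (map (y ∷_) (map (z ∷_) U)) ≡ map (consStats (z <ᵇ y)) (map stats (map (z ∷_) U))
map-stats-∷ y z []      = refl
map-stats-∷ y z (τ ∷ U) = cong₂ _∷_ (stats-∷ y z τ) (map-stats-∷ y z U)

-- The statistics of the insertions behind the first letter: insertionStats without the
-- front insertion (suc k , suc (m + k)).
tailStats : ℕ → ℕ × ℕ → List (ℕ × ℕ)
tailStats n (k , m) = row k m (suc k) ++ row (suc k) (suc (suc (m + k))) (n ∸ k)

insertionStats-tail : ∀ n {k} m → k ≤ n →
  consStats true (k , m) ∷ tailStats n (k , m) ↭ insertionStats (suc n) (k , m)
insertionStats-tail n {k} m k≤n = begin
  (suc k , suc (m + k)) ∷ R₁ ++ R₂   ↭⟨ shift _ R₁ R₂ ⟨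
  R₁ ++ (suc k , suc (m + k)) ∷ R₂   ≡⟨ cong (λ r → R₁ ++ row (suc k) (suc (m + k)) r) (+-∸-assoc 1 k≤n) ⟨
  insertionStats (suc n) (k , m)      ∎
  where
  open PermutationReasoning
  R₁ = row k m (suc k)
  R₂ = row (suc k) (suc (suc (m + k))) (n ∸ k)

tailStats-cons : ∀ c n {k} m → k ≤ n →
  consStats false (consStats true (k , m)) ∷ map (consStats c) (tailStats n (k , m))
    ↭ tailStats (suc n) (consStats c (k , m))
tailStats-cons false n {k} m k≤n = begin
  (suc k , suc (M + suc k)) ∷ map tiltExp (R₁ ++ R₂)
    ≡⟨ cong₂ _∷_ (cong (λ x → (suc k , suc x)) (+-suc M k)) (trans (map-++ _ R₁ R₂) (cong₂ _++_
         (map-row _ (_+ k) (λ _ → refl) (λ _ → refl) m (suc k))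
         (trans (map-row _ (_+ suc k) (λ _ → refl) (λ _ → refl) (suc (suc M)) r)
                (cong (λ x → row (suc k) (suc (suc x)) r) (+-suc M k))))) ⟩
  (suc k , suc (suc (M + k))) ∷ row k M (suc k) ++ row (suc k) (suc (suc (suc (M + k)))) r
    ↭⟨ shift _ (row k M (suc k)) _ ⟨
  row k M (suc k) ++ row (suc k) (suc (suc (M + k))) (suc r)
    ≡⟨ cong (λ r → row k M (suc k) ++ row (suc k) (suc (suc (M + k))) r) (+-∸-assoc 1 k≤n) ⟨
  tailStats (suc n) (k , M) ∎
  where
  open PermutationReasoning
  M = m + k
  r = n ∸ k
  R₁ = row k m (suc k)
  R₂ = row (suc k) (suc (suc M)) r
tailStats-cons true n {k} m k≤n = begin
  Fr ∷ map (shiftExp 1 1 ∘ tiltExp) (R₁ ++ R₂)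
    ≡⟨ cong (Fr ∷_) (trans (map-++ _ R₁ R₂) (cong₂ _++_
         (map-row _ (λ b → suc (b + k)) (λ _ → refl) (λ _ → refl) m (suc k))
         (map-row _ (λ b → suc (b + suc k)) (λ _ → refl) (λ _ → refl) (suc (suc M)) r))) ⟩
  Fr ∷ R₁′ ++ R₂′         ↭⟨ shift Fr R₁′ R₂′ ⟨
  R₁′ ++ Fr ∷ R₂′         ≡⟨ ++-assoc R₁′ [ Fr ] R₂′ ⟨
  (R₁′ ++ [ Fr ]) ++ R₂′  ≡⟨ cong (_++ R₂′) (row-snoc (suc k) (suc M) (suc k)) ⟨
  tailStats (suc n) (suc k , suc M) ∎
  where
  open PermutationReasoning
  M = m + k
  r = n ∸ k
  Fr = (suc k , suc (M + suc k))
  R₁ = row k m (suc k)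
  R₂ = row (suc k) (suc (suc M)) r
  R₁′ = row (suc k) (suc M) (suc k)
  R₂′ = row (suc (suc k)) (suc (suc (suc (M + suc k)))) r

stats-inserts-tail : ∀ {x} z ys → All (_< x) (z ∷ ys) →
  map stats (map (z ∷_) (inserts x ys)) ↭ tailStats (length ys) (stats (z ∷ ys))
stats-inserts-tail z []       (z<x ∷ []) = ↭-reflexive (cong [_] (stats-ascent [] z<x))
stats-inserts-tail {x} y (z ∷ ys) (y<x ∷ z∷ys<x@(z<x ∷ _)) = begin
  stats (y ∷ x ∷ z ∷ ys) ∷ map stats (map (y ∷_) (map (z ∷_) (inserts x ys)))
    ≡⟨ cong₂ _∷_ (trans (stats-ascent (z ∷ ys) y<x) (cong (consStats false) (stats-descent ys z<x)))
                 (map-stats-∷ y z (inserts x ys)) ⟩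
  consStats false (consStats true s) ∷ map (consStats c) (map stats (map (z ∷_) (inserts x ys)))
    ↭⟨ prep _ (map⁺ (consStats c) (stats-inserts-tail z ys z∷ys<x)) ⟩
  consStats false (consStats true s) ∷ map (consStats c) (tailStats (length ys) s)
    ↭⟨ tailStats-cons c (length ys) (proj₂ s) (desFrom-∷-≤ 1 z ys) ⟩
  tailStats (suc (length ys)) (consStats c s)
    ≡⟨ cong (tailStats (suc (length ys))) (stats-∷ y z ys) ⟨
  tailStats (length (z ∷ ys)) (stats (y ∷ z ∷ ys)) ∎
  where
  open PermutationReasoning
  s = stats (z ∷ ys)
  c = z <ᵇ y

stats-inserts : ∀ {x} σ → All (_< x) σ → map stats (inserts x σ) ↭ insertionStats (length σ) (stats σ)
stats-inserts []           []                  = ↭-refl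
stats-inserts {x} (z ∷ ys) z∷ys<x@(z<x ∷ _) = begin
  stats (x ∷ z ∷ ys) ∷ map stats (map (z ∷_) (inserts x ys))
    ≡⟨ cong (_∷ map stats (map (z ∷_) (inserts x ys))) (stats-descent ys z<x) ⟩
  consStats true s ∷ map stats (map (z ∷_) (inserts x ys))
    ↭⟨ prep _ (stats-inserts-tail z ys z∷ys<x) ⟩
  consStats true s ∷ tailStats (length ys) s
    ↭⟨ insertionStats-tail (length ys) (proj₂ s) (desFrom-∷-≤ 1 z ys) ⟩
  insertionStats (suc (length ys)) s ∎
  where
  open PermutationReasoning
  s = stats (z ∷ ys)

-- Permutations by insertion

perms : ℕ → List (List ℕ)
perms zero    = [ [] ]
perms (suc n) = concatMap (inserts n) (perms n)

∈-inserts⁻ : ∀ {x} σ {τ} → τ ∈ inserts x σ → ∃₂ λ as bs → σ ≡ as ++ bs × τ ≡ as ++ x ∷ bs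
∈-inserts⁻ []       (here refl) = [] , [] , refl , refl
∈-inserts⁻ (y ∷ ys) (here refl) = [] , y ∷ ys , refl , refl
∈-inserts⁻ (y ∷ ys) (there τ∈)  with ∈-map⁻ (y ∷_) τ∈
... | τ′ , τ′∈ , refl with ∈-inserts⁻ ys τ′∈
...   | as , bs , refl , refl = y ∷ as , bs , refl , refl

∈-inserts⁺ : ∀ {x} as bs → as ++ x ∷ bs ∈ inserts x (as ++ bs)
∈-inserts⁺ []       []       = here refl
∈-inserts⁺ []       (b ∷ bs) = here refl
∈-inserts⁺ (a ∷ as) bs       = there (∈-map⁺ (a ∷_) (∈-inserts⁺ as bs))

inserts-unique : ∀ {x} σ → x ∉ σ → Unique (inserts x σ)
inserts-unique []           _   = [] ∷ []
inserts-unique {x} (y ∷ ys) x∉σ =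
  All.tabulate front-new ∷ Unique.map⁺ ∷-injectiveʳ (inserts-unique ys (x∉σ ∘ there))
  where
  front-new : ∀ {τ} → τ ∈ map (y ∷_) (inserts x ys) → x ∷ y ∷ ys ≢ τ
  front-new τ∈ eq with ∈-map⁻ (y ∷_) τ∈
  ... | _ , _ , refl = x∉σ (here (∷-injectiveˡ eq))

remove-inserted : ∀ {x} σ {τ} → x ∉ σ → τ ∈ inserts x σ → filter (¬? ∘ (x ≟_)) τ ≡ σ
remove-inserted {x} σ x∉σ τ∈ with ∈-inserts⁻ σ τ∈
... | as , bs , refl , refl = begin
  filter P? (as ++ x ∷ bs)           ≡⟨ filter-++ P? as (x ∷ bs) ⟩
  filter P? as ++ filter P? (x ∷ bs) ≡⟨ cong (filter P? as ++_) (filter-reject P? (λ x≢x → x≢x refl)) ⟩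
  filter P? as ++ filter P? bs       ≡⟨ filter-++ P? as bs ⟨
  filter P? (as ++ bs)               ≡⟨ filter-all P? (All.¬Any⇒All¬ (as ++ bs) x∉σ) ⟩
  as ++ bs                           ∎
  where
  open ≡-Reasoning
  P? = ¬? ∘ (x ≟_)

inserts-injective : ∀ {x σ σ′ τ} → x ∉ σ → x ∉ σ′ → τ ∈ inserts x σ → τ ∈ inserts x σ′ → σ ≡ σ′
inserts-injective {σ = σ} {σ′} x∉σ x∉σ′ τ∈ τ∈′ =
  trans (sym (remove-inserted σ x∉σ τ∈)) (remove-inserted σ′ x∉σ′ τ∈′)

concatMap-inserts-unique : ∀ {x L} → Unique L → All (x ∉_) L → Unique (concatMap (inserts x) L)
concatMap-inserts-unique {L = []}    []         []          = []
concatMap-inserts-unique {x} {σ ∷ L} (σ∉L ∷ uL) (x∉σ ∷ x∉L) =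
  Unique.++⁺ (inserts-unique σ x∉σ) (concatMap-inserts-unique uL x∉L) disjoint
  where
  disjoint : ∀ {τ} → ¬ (τ ∈ inserts x σ × τ ∈ concatMap (inserts x) L)
  disjoint (τ∈ , τ∈L) with find (∈-concatMap⁻ (inserts x) {xs = L} τ∈L)
  ... | σ′ , σ′∈L , τ∈′ = All.lookup σ∉L σ′∈L (inserts-injective x∉σ (All.lookup x∉L σ′∈L) τ∈ τ∈′)

DistinctBelow : ℕ → List ℕ → Set
DistinctBelow n l = Unique l × All (_< n) l

IsPerm : ℕ → List ℕ → Set
IsPerm d l = DistinctBelow d l × length l ≡ d

below-pred : ∀ {n l} → All (_< suc n) l → n ∉ l → All (_< n) l
below-pred l<sn n∉l = All.tabulate (λ {y} y∈l →
  ≤∧≢⇒< (≤-pred (All.lookup l<sn y∈l)) (λ y≡n → n∉l (subst (_∈ _) y≡n y∈l)))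

DistinctBelow-∷ : ∀ {n σ} → DistinctBelow n σ → DistinctBelow (suc n) (n ∷ σ)
DistinctBelow-∷ {n} (u , σ<n) =
  All.map (λ y<n n≡y → <-irrefl (sym n≡y) y<n) σ<n ∷ u , n<1+n n ∷ All.map m<n⇒m<1+n σ<n

DistinctBelow-∷⁻ : ∀ {n σ} → DistinctBelow (suc n) (n ∷ σ) → DistinctBelow n σ
DistinctBelow-∷⁻ (n∉σ ∷ u , _ ∷ σ<sn) = u , below-pred σ<sn (All.All¬⇒¬Any n∉σ)

DistinctBelow-resp-↭ : ∀ {n l l′} → l ↭ l′ → DistinctBelow n l → DistinctBelow n l′
DistinctBelow-resp-↭ l↭l′ (u , l<n) = Unique-resp-↭ (↭⇒↭ₛ l↭l′) u , All-resp-↭ l↭l′ l<n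

DistinctBelow⇒length≤ : ∀ n {l} → DistinctBelow n l → length l ≤ n
DistinctBelow⇒length≤ zero    {[]}    _            = z≤n
DistinctBelow⇒length≤ zero    {_ ∷ _} (_ , () ∷ _)
DistinctBelow⇒length≤ (suc n) {l}     (u , l<sn) with n ∈? l
... | no  n∉l = m≤n⇒m≤1+n (DistinctBelow⇒length≤ n (u , below-pred l<sn n∉l))
... | yes n∈l with as , bs , refl ← ∈-∃++ n∈l =
  subst (_≤ suc n) (sym (length-++-sucʳ as n bs))
    (s≤s (DistinctBelow⇒length≤ n (DistinctBelow-∷⁻ (DistinctBelow-resp-↭ (shift n as bs) (u , l<sn)))))

IsPerm-∷ : ∀ {n σ} → IsPerm n σ → IsPerm (suc n) (n ∷ σ)
IsPerm-∷ (dσ , |σ|≡n) = DistinctBelow-∷ dσ , cong suc |σ|≡n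

IsPerm-resp-↭ : ∀ {d l l′} → l ↭ l′ → IsPerm d l → IsPerm d l′
IsPerm-resp-↭ l↭l′ (dl , |l|≡d) = DistinctBelow-resp-↭ l↭l′ dl , trans (sym (↭-length l↭l′)) |l|≡d

IsPerm-remove-max : ∀ {n} as bs → IsPerm (suc n) (as ++ n ∷ bs) → IsPerm n (as ++ bs)
IsPerm-remove-max {n} as bs (dl , |l|≡) =
  DistinctBelow-∷⁻ (DistinctBelow-resp-↭ (shift n as bs) dl) ,
  suc-injective (trans (sym (length-++-sucʳ as n bs)) |l|≡)

IsPerm-∋-max : ∀ {n l} → IsPerm (suc n) l → n ∈ l
IsPerm-∋-max {n} {l} ((u , l<sn) , |l|≡) with n ∈? l
... | yes n∈l = n∈l
... | no  n∉l =
  ⊥-elim (<-irrefl refl (subst (_≤ n) |l|≡ (DistinctBelow⇒length≤ n (u , below-pred l<sn n∉l))))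

∈-perms⇒IsPerm : ∀ d {l} → l ∈ perms d → IsPerm d l
∈-perms⇒IsPerm zero    (here refl) = ([] , []) , refl
∈-perms⇒IsPerm (suc n) l∈ with find (∈-concatMap⁻ (inserts n) {xs = perms n} l∈)
... | σ , σ∈ , l∈σ with ∈-inserts⁻ σ l∈σ
...   | as , bs , refl , refl = IsPerm-resp-↭ (↭-sym (shift n as bs)) (IsPerm-∷ (∈-perms⇒IsPerm n σ∈))

IsPerm⇒∈-perms : ∀ d {l} → IsPerm d l → l ∈ perms d
IsPerm⇒∈-perms zero    {[]} _ = here refl
IsPerm⇒∈-perms (suc n) p with as , bs , refl ← ∈-∃++ (IsPerm-∋-max p) =
  ∈-concatMap⁺ (inserts n) (lose (IsPerm⇒∈-perms n (IsPerm-remove-max as bs p)) (∈-inserts⁺ as bs))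

perms-unique : ∀ d → Unique (perms d)
perms-unique zero    = [] ∷ []
perms-unique (suc n) = concatMap-inserts-unique (perms-unique n) (All.tabulate (λ σ∈ n∈σ →
  <-irrefl refl (All.lookup (proj₂ (proj₁ (∈-perms⇒IsPerm n σ∈))) n∈σ)))

stats-concatMap-inserts : ∀ {n} L → All (IsPerm n) L →
  map stats (concatMap (inserts n) L) ↭ concatMap (insertionStats n) (map stats L)
stats-concatMap-inserts {n} L perms-L = begin
  map stats (concatMap (inserts n) L)          ≡⟨ map-concatMap stats (inserts n) L ⟩
  concatMap (map stats ∘ inserts n) L          ↭⟨ concatMap-cong-↭ (All.map stats-inserts-perm perms-L) ⟩
  concatMap (insertionStats n ∘ stats) L       ≡⟨ concatMap-map (insertionStats n) stats L ⟨
  concatMap (insertionStats n) (map stats L)   ∎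
  where
  open PermutationReasoning
  stats-inserts-perm : ∀ {σ} → IsPerm n σ → map stats (inserts n σ) ↭ insertionStats n (stats σ)
  stats-inserts-perm {σ} ((_ , σ<n) , refl) = stats-inserts σ σ<n

F-perms : ∀ n → F (suc n) ≗₂ series (map stats (perms (suc n)))
F-perms zero    zero    zero    = refl
F-perms zero    zero    (suc j) = refl
F-perms zero    (suc i) zero    = refl
F-perms zero    (suc i) (suc j) = refl
F-perms (suc n) i j = trans
  (step-series (suc n) (map stats σs) (F-perms n) (All.map⁺ (All.map des-bounded σs-perms)) i j)
  (series-↭ (↭-sym (stats-concatMap-inserts σs σs-perms)) i j)
  where
  σs = perms (suc n)
  σs-perms : All (IsPerm (suc n)) σs
  σs-perms = All.tabulate (∈-perms⇒IsPerm (suc n))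
  des-bounded : ∀ {σ} → IsPerm (suc n) σ → desFrom 1 σ ≤ suc n
  des-bounded {σ} (_ , |σ|≡) = subst (desFrom 1 σ ≤_) |σ|≡ (desFrom-≤ 1 σ)

-- Permutations as duplicate-free words

words-complete : ∀ {d} n (τ : Vec (Fin d) n) → τ ∈ words d n
words-complete zero    Vec.[]      = here refl
words-complete (suc n) (a Vec.∷ τ) =
  ∈-concat⁺′ (∈-map⁺ (a Vec.∷_) (words-complete n τ))
             (∈-map⁺ (λ x → map (x Vec.∷_) (words _ n)) (∈-allFin a))

words-unique : ∀ d n → Unique (words d n)
words-unique d zero    = [] ∷ []
words-unique d (suc n) = Unique.concat⁺
  (All.map⁺ (All.universal (λ a → Unique.map⁺ Vec.∷-injectiveʳ (words-unique d n)) (allFin d)))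
  (AllPairs.map⁺ (AllPairs.map disjoint (Unique.allFin⁺ d)))
  where
  disjoint : ∀ {a b : Fin d} → a ≢ b →
             ∀ {v} → ¬ (v ∈ map (a Vec.∷_) (words d n) × v ∈ map (b Vec.∷_) (words d n))
  disjoint a≢b (v∈a , v∈b) with ∈-map⁻ (_ Vec.∷_) v∈a | ∈-map⁻ (_ Vec.∷_) v∈b
  ... | _ , _ , refl | _ , _ , eq = a≢b (Vec.∷-injectiveˡ eq)

oneLine : ∀ {d n} → Vec (Fin d) n → List ℕ
oneLine τ = map toℕ (toList τ)

permWords : (d : ℕ) → List (Vec (Fin d) d)
permWords d = filter (λ τ → UniqueDec.unique? (Fin._≟_ {d}) (toList τ)) (words d d)

∈-oneLines⇒IsPerm : ∀ d {l} → l ∈ map oneLine (permWords d) → IsPerm d l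
∈-oneLines⇒IsPerm d l∈ with ∈-map⁻ oneLine l∈
... | τ , τ∈ , refl with ∈-filter⁻ (λ τ → UniqueDec.unique? Fin._≟_ (toList τ)) {xs = words d d} τ∈
...   | _ , uτ = (Unique.map⁺ toℕ-injective uτ , All.map⁺ (All.universal toℕ<n (toList τ))) ,
                 trans (length-map toℕ (toList τ)) (length-toList τ)

fromList< : ∀ {d} l → All (_< d) l → Vec (Fin d) (length l)
fromList< []      []          = Vec.[]
fromList< (x ∷ l) (x<d ∷ l<d) = fromℕ< x<d Vec.∷ fromList< l l<d

oneLine-fromList< : ∀ {d} l (l<d : All (_< d) l) → oneLine (fromList< l l<d) ≡ l
oneLine-fromList< []      []          = refl
oneLine-fromList< (x ∷ l) (x<d ∷ l<d) = cong₂ _∷_ (toℕ-fromℕ< x<d) (oneLine-fromList< l l<d)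

IsPerm⇒∈-oneLines : ∀ {d l} → IsPerm d l → l ∈ map oneLine (permWords d)
IsPerm⇒∈-oneLines {l = l} ((u , l<d) , refl) = subst (_∈ _) (oneLine-fromList< l l<d)
  (∈-map⁺ oneLine (∈-filter⁺ (λ τ → UniqueDec.unique? Fin._≟_ (toList τ)) (words-complete _ τ)
    (Unique.map⁻ (subst Unique (sym (oneLine-fromList< l l<d)) u))))
  where τ = fromList< l l<d

oneLines-unique : ∀ d → Unique (map oneLine (permWords d))
oneLines-unique d = Unique.map⁺ oneLine-injective (Unique.filter⁺ _ (words-unique d d))
  where
  oneLine-injective : ∀ {τ τ′ : Vec (Fin d) d} → oneLine τ ≡ oneLine τ′ → τ ≡ τ′
  oneLine-injective {τ} {τ′} eq =
    trans (sym (cast-is-id refl τ)) (toList-injective refl τ τ′ (map-injective toℕ-injective eq))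

oneLines↭perms : ∀ d → map oneLine (permWords d) ↭ perms d
oneLines↭perms d = ∼bag⇒↭ (unique∧set⇒bag (oneLines-unique d) (perms-unique d)
  (mk⇔ (IsPerm⇒∈-perms d ∘ ∈-oneLines⇒IsPerm d) (IsPerm⇒∈-oneLines ∘ ∈-perms⇒IsPerm d)))

-- The filter defining E tests des τ ≡ i and maj τ ≡ j, which is atExponent? i j (stats (oneLine τ))
-- up to unfolding.
E-perms : ∀ d i j → + E d i j ≡ series (map stats (perms d)) i j
E-perms d i j = cong +_ (begin
  E d i j
    ≡⟨ cong length (filter-×-dec _ (atExponent? i j ∘ stats ∘ oneLine) (words d d)) ⟩
  length (filter (atExponent? i j ∘ stats ∘ oneLine) (permWords d))
    ≡⟨ length-filter-map (atExponent? i j) (stats ∘ oneLine) (permWords d) ⟨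
  length (filter (atExponent? i j) (map (stats ∘ oneLine) (permWords d)))
    ≡⟨ cong (length ∘ filter (atExponent? i j)) (map-∘ (permWords d)) ⟩
  length (filter (atExponent? i j) (map stats (map oneLine (permWords d))))
    ≡⟨ ↭-length (filter-↭ (atExponent? i j) (map⁺ stats (oneLines↭perms d))) ⟩
  length (filter (atExponent? i j) (map stats (perms d))) ∎)
  where open ≡-Reasoning

theorem1p1 : (d : ℕ) → 1 ≤ d → (i j : ℕ) → F d i j ≡ + E d i j
theorem1p1 (suc n) _ i j = trans (F-perms n i j) (sym (E-perms (suc n) i j))
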